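{- Let $n\geq 3$, let $L_n$ be the line graph of an $n$-dimensional hypercube-like network, and let $S\subset E(L_n)$ with $|S|\leq 4n-7$. Then $L_n-S$ has a connected component with at least $n2^{n-1}-1$ vertices.
   Context: For two disjoint graphs $G_1,G_2$ with the same number of vertices and a bijection $f:V(G_1)\to V(G_2)$, $G_1\oplus_f G_2$ denotes the graph obtained from $G_1\cup G_2$ by adding the edges $(v,f(v))$ for all $v\in V(G_1)$. The $n$-dimensional hypercube-like networks are defined recursively: $K_2$ is the only $1$-dimensional hypercube-like network; for $n\geq 2$, if $Q^1_{n-1}$ and $Q^2_{n-1}$ are (disjoint) $(n-1)$-dimensional hypercube-like networks, then $Q^1_{n-1}\oplus_f Q^2_{n-1}$ is an $n$-dimensional hypercube-like network for every bijection $f$. The line graph $L(G)$ of a graph $G$ has vertex set $E(G)$, two vertices being adjacent iff the corresponding edges share an end-vertex. ($L_n$ has $n2^{n-1}$ vertices.) -}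

module Defs where

open import Data.Nat using (ℕ; zero; suc; _+_; _*_; _∸_; _^_; _≤_)
open import Data.Bool using (Bool; true; false)
open import Data.Unit using (⊤; tt)
open import Data.Product using (Σ; ∃; _×_; _,_; proj₁; proj₂)
open import Data.Sum using (_⊎_)
open import Data.List using (List; length)
open import Data.List.Membership.Propositional using (_∈_)
open import Data.List.Relation.Unary.All using (All)
open import Data.List.Relation.Unary.AllPairs using (AllPairs)
open import Relation.Binary.PropositionalEquality using (_≡_; _≢_)
open import Relation.Binary.Construct.Closure.ReflexiveTransitive using (Star)
open import Relation.Nullary using (¬_)
open import Function.Bundles using (Bijection; _⤖_)

-- The Bool component of
-- V (suc (suc n)) says in which of the two (n+1)-dimensional halves a
-- vertex lies.  (Graphs are taken up to isomorphism, so fixing the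
-- vertex set is harmless.)
V : ℕ → Set
V zero    = ⊤
V (suc n) = Bool × V n

Graph : Set → Set₁
Graph A = A → A → Set

K₂ : Graph (V 1)
K₂ (a , _) (b , _) = a ≢ b

⊕ : ∀ {A : Set} → Graph A → Graph A → (A → A) → Graph (Bool × A)
⊕ G₁ G₂ f (false , x) (false , y) = G₁ x y
⊕ G₁ G₂ f (true  , x) (true  , y) = G₂ x y
⊕ G₁ G₂ f (false , x) (true  , y) = f x ≡ y
⊕ G₁ G₂ f (true  , x) (false , y) = f y ≡ x

data HL : (n : ℕ) → Graph (V n) → Set₁ where
  base : HL 1 K₂
  step : ∀ {n} {G₁ G₂ : Graph (V (suc n))} →
         HL (suc n) G₁ → HL (suc n) G₂ →
         (f : V (suc n) ⤖ V (suc n)) →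
         HL (suc (suc n)) (⊕ G₁ G₂ (Bijection.to f))

-- Line graph.  Vertices of L(G): edges of G, represented as an adjacent
-- ordered pair; two representatives denote the same edge iff they have
-- the same end-vertices (in either order).
LV : ∀ {A : Set} → Graph A → Set
LV {A} G = Σ (A × A) (λ p → G (proj₁ p) (proj₂ p))

_≈E_ : ∀ {A : Set} {G : Graph A} → LV G → LV G → Set
((u , v) , _) ≈E ((u' , v') , _) = (u ≡ u' × v ≡ v') ⊎ (u ≡ v' × v ≡ u')

LAdj : ∀ {A : Set} (G : Graph A) → LV G → LV G → Set
LAdj G e@((u , v) , _) e'@((u' , v') , _) =
  ¬ (_≈E_ {G = G} e e') × ((u ≡ u' ⊎ u ≡ v') ⊎ (v ≡ u' ⊎ v ≡ v'))

-- a set S of edges of L(G), given as a list of pairs of L(G)-vertices;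
-- a pair {a , b} of L(G)-vertices is deleted iff it equals (as an
-- unordered pair of edges of G) some member of S
InS : ∀ {A : Set} {G : Graph A} → List (LV G × LV G) → LV G → LV G → Set
InS {G = G} S a b = ∃ λ st → st ∈ S ×
  ((_≈E_ {G = G} a (proj₁ st) × _≈E_ {G = G} b (proj₂ st)) ⊎
   (_≈E_ {G = G} a (proj₂ st) × _≈E_ {G = G} b (proj₁ st)))

LminusAdj : ∀ {A : Set} (G : Graph A) → List (LV G × LV G) → LV G → LV G → Set
LminusAdj G S a b = LAdj G a b × ¬ InS {G = G} S a b

-- L(G) - S has a connected component with at least m vertices:
-- there is a vertex c and a list of at least m pairwise distinct
-- vertices, each joined to c by a path in L(G) - S
HasComponentOfSize : ∀ {A : Set} (G : Graph A) → List (LV G × LV G) → ℕ → Set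
HasComponentOfSize G S m =
  ∃ λ (c : LV G) → ∃ λ (vs : List (LV G)) →
    m ≤ length vs ×
    AllPairs (λ a b → ¬ _≈E_ {G = G} a b) vs ×
    All (λ a → Star (LminusAdj G S) c a) vs

{-# OPTIONS --safe #-}
module Submission where

-- An n-dimensional hypercube-like network G is n-regular, triangle-free, has n 2^(n-1) edges and stays
-- connected after deleting any n - 1 vertices; all of this is proved along the recursive construction.
-- The n edges at a vertex v form a clique of L(G).  Call v split if S cuts some pair ij of them and
-- every other edge l at v is cut from i or from j; otherwise the clique stays connected in L(G) - S.
-- A split vertex costs n - 1 distinct edges of S inside its clique, and cliques at different vertices
-- share no edge of L(G), so (n - 1) #split <= 4n - 7 and at most three vertices are split.  The other
-- vertices stay connected in G, so all edges with an unsplit end lie in one component of L(G) - S.  An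
-- edge outside it has both ends split and is cut from all its neighbours with an unsplit end; two such
-- edges would share a split vertex, and counting their cuts gives 4n - 6 > |S|.

open import Defs
open import Data.Nat using (ℕ; zero; suc; _+_; _*_; _∸_; _^_; _≤_; z≤n; s≤s; _≤?_)
import Data.Nat.Properties as ℕP
open import Data.Nat.Tactic.RingSolver using (solve-∀)
open import Data.Bool as Bool using (Bool; true; false)
open import Data.Unit using (tt)
open import Data.Empty using (⊥; ⊥-elim)
open import Data.Product using (∃; ∃₂; _×_; _,_; proj₁; proj₂; swap)
open import Data.Product.Properties using (≡-dec)
open import Data.Sum as Sum using (_⊎_; inj₁; inj₂)
open import Data.Fin as Fin using (Fin; zero; suc; punchIn; punchOut)
import Data.Fin.Properties as FinP
open import Data.List using (List; []; _∷_; length; map; _++_; filter; lookup; tabulate)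
open import Data.List.Properties
  using (length-map; length-++; length-tabulate; filter-all; filter-accept; filter-reject)
open import Data.List.Membership.Propositional using (_∈_; _∉_; find; lose)
open import Data.List.Membership.Propositional.Properties
  using (∈-map⁺; ∈-++⁺ˡ; ∈-++⁺ʳ; ∈-filter⁺; ∈-filter⁻; ∈-lookup)
import Data.List.Membership.DecPropositional as DecMembership
open import Data.List.Relation.Unary.All as All using (All; []; _∷_)
import Data.List.Relation.Unary.All.Properties as AllP
open import Data.List.Relation.Unary.Any as Any using (Any; here; there)
import Data.List.Relation.Unary.Any.Properties as AnyP
open import Data.List.Relation.Unary.AllPairs as AllPairs using (AllPairs; []; _∷_)
import Data.List.Relation.Unary.AllPairs.Properties as AllPairsP
open import Relation.Binary.PropositionalEquality
open import Relation.Binary.Definitions using (DecidableEquality)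
open import Relation.Binary.Construct.Closure.ReflexiveTransitive as Star using (Star; ε; _◅_; _◅◅_; gmap)
open import Relation.Nullary using (¬_; Dec; yes; no)
open import Relation.Nullary.Decidable using (_×-dec_; _⊎-dec_; _→-dec_; ¬?; map′; decidable-stable)
open import Function.Bundles using (Bijection; _⤖_)
open import Function using (_∘′_)

_≟V_ : ∀ {n} → DecidableEquality (V n)
_≟V_ {zero}  _ _ = yes refl
_≟V_ {suc n} = ≡-dec Bool._≟_ _≟V_

allV : ∀ n → List (V n)
allV zero    = tt ∷ []
allV (suc n) = map (false ,_) (allV n) ++ map (true ,_) (allV n)

∈-allV : ∀ n (x : V n) → x ∈ allV n
∈-allV zero    x           = here refl
∈-allV (suc n) (false , x) = ∈-++⁺ˡ (∈-map⁺ (false ,_) (∈-allV n x))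
∈-allV (suc n) (true , x)  = ∈-++⁺ʳ _ (∈-map⁺ (true ,_) (∈-allV n x))

allV-distinct : ∀ n → AllPairs _≢_ (allV n)
allV-distinct zero    = [] ∷ []
allV-distinct (suc n) = AllPairsP.++⁺ (inCopy false) (inCopy true)
  (AllP.map⁺ (All.tabulate λ _ → AllP.map⁺ (All.tabulate λ _ ())))
  where
  inCopy : ∀ b → AllPairs _≢_ (map (b ,_) (allV n))
  inCopy b = AllPairsP.map⁺ (AllPairs.map (λ x≢y → x≢y ∘′ cong proj₂) (allV-distinct n))

length-allV : ∀ n → length (allV n) ≡ 2 ^ n
length-allV zero    = refl
length-allV (suc n) =
  trans (length-++ (copy false)) (cong₂ _+_ (length-copy false) (trans (length-copy true) (sym (ℕP.+-identityʳ _))))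
  where
  copy : Bool → List (V (suc n))
  copy b = map (b ,_) (allV n)
  length-copy : ∀ b → length (copy b) ≡ 2 ^ n
  length-copy b = trans (length-map (b ,_) (allV n)) (length-allV n)

embedFin : ∀ m → Fin (suc m) → V m
embedFin zero    _       = tt
embedFin (suc m) zero    = false , embedFin m zero
embedFin (suc m) (suc k) = true , embedFin m k

embedFin-injective : ∀ m {i j} → embedFin m i ≡ embedFin m j → i ≡ j
embedFin-injective zero    {zero}  {zero}  _  = refl
embedFin-injective (suc m) {zero}  {zero}  _  = refl
embedFin-injective (suc m) {suc i} {suc j} eq = cong suc (embedFin-injective m (cong proj₂ eq))

injection⇒≤length : ∀ {A : Set} {K} (xs : List A) (φ : Fin K → A) →
                    (∀ k → φ k ∈ xs) → (∀ {i j} → φ i ≡ φ j → i ≡ j) → K ≤ length xs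
injection⇒≤length xs φ φ∈xs φ-injective = FinP.injective⇒≤ λ {i} {j} eq →
  φ-injective (begin
    φ i                             ≡⟨ AnyP.lookup-index (φ∈xs i) ⟩
    lookup xs (Any.index (φ∈xs i))  ≡⟨ cong (lookup xs) eq ⟩
    lookup xs (Any.index (φ∈xs j))  ≡⟨ AnyP.lookup-index (φ∈xs j) ⟨
    φ j                             ∎)
  where open ≡-Reasoning

lookup-injective-up-to : ∀ {A : Set} {xs : List A} (Same : A → A → Set) → (∀ {x y} → Same x y → Same y x) →
                         AllPairs (λ x y → ¬ Same x y) xs →
                         ∀ {i j} → Same (lookup xs i) (lookup xs j) → i ≡ j
lookup-injective-up-to _    _   (_  ∷ _)   {zero}  {zero}  _    = refl
lookup-injective-up-to _    _   (x≁ ∷ _)   {zero}  {suc j} same = ⊥-elim (All.lookup x≁ (∈-lookup j) same)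
lookup-injective-up-to _    sym (x≁ ∷ _)   {suc i} {zero}  same = ⊥-elim (All.lookup x≁ (∈-lookup i) (sym same))
lookup-injective-up-to Same sym (_  ∷ xs≁) {suc i} {suc j} same = cong suc (lookup-injective-up-to Same sym xs≁ same)

distinct-⊆⇒≤length : ∀ {A : Set} {ys xs : List A} → AllPairs _≢_ ys → All (_∈ xs) ys →
                     length ys ≤ length xs
distinct-⊆⇒≤length {ys = ys} {xs} ys≢ ys⊆xs =
  injection⇒≤length xs (lookup ys) (λ k → All.lookup ys⊆xs (∈-lookup k)) (lookup-injective-up-to _≡_ sym ys≢)

All-across : ∀ {A : Set} {P Q : A → Set} {R : A → A → Set} {xs ys : List A} →
             (∀ {x y} → P x → Q y → R x y) → All P xs → All Q ys → All (λ x → All (R x) ys) xs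
All-across R-PQ Pxs Qys = All.map (λ Px → All.map (R-PQ Px) Qys) Pxs

all-or-any : ∀ {A : Set} {P Q : A → Set} → (∀ x → P x ⊎ Q x) → ∀ xs → All P xs ⊎ Any Q xs
all-or-any P⊎Q []       = inj₁ []
all-or-any P⊎Q (x ∷ xs) with P⊎Q x | all-or-any P⊎Q xs
... | inj₁ Px | inj₁ Pxs = inj₁ (Px ∷ Pxs)
... | inj₁ _  | inj₂ Qxs = inj₂ (there Qxs)
... | inj₂ Qx | _        = inj₂ (here Qx)

module _ {m : ℕ} where
  open DecMembership (_≟V_ {m}) using (_∈?_)

  missing-vertex : (B : List (V m)) → length B ≤ m → ∃ λ x → x ∉ B
  missing-vertex B |B|≤m with FinP.any? (λ k → ¬? (embedFin m k ∈? B))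
  ... | yes (k , k∉B) = embedFin m k , k∉B
  ... | no none       = ⊥-elim (ℕP.<⇒≱ (s≤s |B|≤m)
    (injection⇒≤length B (embedFin m) (λ k → decidable-stable (embedFin m k ∈? B) (λ k∉B → none (k , k∉B)))
                       (embedFin-injective m)))

module _ {A : Set} where
  half : Bool → List (Bool × A) → List A
  half _     []                 = []
  half false ((false , x) ∷ B) = x ∷ half false B
  half false ((true  , _) ∷ B) = half false B
  half true  ((false , _) ∷ B) = half true B
  half true  ((true  , x) ∷ B) = x ∷ half true B

  ∈-half⁺ : ∀ b {x} (B : List (Bool × A)) → (b , x) ∈ B → x ∈ half b B
  ∈-half⁺ false ((false , _) ∷ B) (here refl) = here refl
  ∈-half⁺ true  ((true  , _) ∷ B) (here refl) = here refl
  ∈-half⁺ false ((false , _) ∷ B) (there x∈B) = there (∈-half⁺ false B x∈B)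
  ∈-half⁺ false ((true  , _) ∷ B) (there x∈B) = ∈-half⁺ false B x∈B
  ∈-half⁺ true  ((false , _) ∷ B) (there x∈B) = ∈-half⁺ true B x∈B
  ∈-half⁺ true  ((true  , _) ∷ B) (there x∈B) = there (∈-half⁺ true B x∈B)

  ∈-half⁻ : ∀ b {x} (B : List (Bool × A)) → x ∈ half b B → (b , x) ∈ B
  ∈-half⁻ false ((false , _) ∷ B) (here refl) = here refl
  ∈-half⁻ true  ((true  , _) ∷ B) (here refl) = here refl
  ∈-half⁻ false ((false , _) ∷ B) (there x∈) = there (∈-half⁻ false B x∈)
  ∈-half⁻ false ((true  , _) ∷ B) x∈         = there (∈-half⁻ false B x∈)
  ∈-half⁻ true  ((false , _) ∷ B) x∈         = there (∈-half⁻ true B x∈)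
  ∈-half⁻ true  ((true  , _) ∷ B) (there x∈) = there (∈-half⁻ true B x∈)

  length-halves : (B : List (Bool × A)) → length (half false B) + length (half true B) ≡ length B
  length-halves []                = refl
  length-halves ((false , _) ∷ B) = cong suc (length-halves B)
  length-halves ((true  , _) ∷ B) = trans (ℕP.+-suc (length (half false B)) _) (cong suc (length-halves B))

Avoid : ∀ {A : Set} → Graph A → List A → Graph A
Avoid G B a b = G a b × b ∉ B

reverse-avoiding : ∀ {A : Set} {G : Graph A} {B : List A} → (∀ {a b} → G a b → G b a) →
                   ∀ {x y} → x ∉ B → Star (Avoid G B) x y → Star (Avoid G B) y x
reverse-avoiding sym x∉B ε                = ε
reverse-avoiding sym x∉B ((g , b∉B) ◅ p) = reverse-avoiding sym b∉B p ◅◅ ((sym g , x∉B) ◅ ε)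

record HLFacts (m : ℕ) (G : Graph (V (suc m))) : Set₁ where
  field
    nbr                : V (suc m) → Fin (suc m) → V (suc m)
    nbr-adjacent       : ∀ v i → G v (nbr v i)
    nbr-injective      : ∀ v {i j} → nbr v i ≡ nbr v j → i ≡ j
    nbr-surjective     : ∀ {v w} → G v w → ∃ λ i → nbr v i ≡ w
    adj-sym            : ∀ {a b} → G a b → G b a
    adj-irrefl         : ∀ {a} → ¬ G a a
    triangle-free      : ∀ {a b c} → G a b → G b c → ¬ G a c
    edges              : List (LV G)
    length-edges       : length edges ≡ suc m * 2 ^ m
    edges-distinct     : AllPairs (λ e e′ → ¬ _≈E_ {G = G} e e′) edges
    edges-complete     : ∀ e → Any (_≈E_ {G = G} e) edges
    connected-avoiding : ∀ B → length B ≤ m → ∀ {x y} → x ∉ B → y ∉ B → Star (Avoid G B) x y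

K₂-facts : HLFacts 0 K₂
K₂-facts = record
  { nbr                = λ v _ → Bool.not (proj₁ v) , tt
  ; nbr-adjacent       = λ v _ → not-≢ (proj₁ v)
  ; nbr-injective      = λ { _ {zero} {zero} _ → refl }
  ; nbr-surjective     = surjective
  ; adj-sym            = λ a≢b → a≢b ∘′ sym
  ; adj-irrefl         = λ a≢a → a≢a refl
  ; triangle-free      = triangle-free
  ; edges              = (((false , tt) , (true , tt)) , λ ()) ∷ []
  ; length-edges       = refl
  ; edges-distinct     = [] ∷ []
  ; edges-complete     = complete
  ; connected-avoiding = connected
  }
  where
  not-≢ : ∀ a → a ≢ Bool.not a
  not-≢ false ()
  not-≢ true  ()
  surjective : ∀ {v w : V 1} → K₂ v w → ∃ λ (_ : Fin 1) → (Bool.not (proj₁ v) , tt) ≡ w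
  surjective {false , tt} {false , tt} a≢b = ⊥-elim (a≢b refl)
  surjective {false , tt} {true  , tt} _   = zero , refl
  surjective {true  , tt} {false , tt} _   = zero , refl
  surjective {true  , tt} {true  , tt} a≢b = ⊥-elim (a≢b refl)
  triangle-free : ∀ {a b c : V 1} → K₂ a b → K₂ b c → ¬ K₂ a c
  triangle-free {false , _} {false , _} {_}         a≢b _   _   = a≢b refl
  triangle-free {true  , _} {true  , _} {_}         a≢b _   _   = a≢b refl
  triangle-free {false , _} {true  , _} {false , _} _   _   a≢c = a≢c refl
  triangle-free {false , _} {true  , _} {true  , _} _   b≢c _   = b≢c refl
  triangle-free {true  , _} {false , _} {false , _} _   b≢c _   = b≢c refl
  triangle-free {true  , _} {false , _} {true  , _} _   _   a≢c = a≢c refl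
  complete : ∀ (e : LV K₂) → Any (_≈E_ {G = K₂} e) ((((false , tt) , (true , tt)) , λ ()) ∷ [])
  complete (((false , tt) , (false , tt)) , a≢b) = ⊥-elim (a≢b refl)
  complete (((false , tt) , (true  , tt)) , _)   = here (inj₁ (refl , refl))
  complete (((true  , tt) , (false , tt)) , _)   = here (inj₂ (refl , refl))
  complete (((true  , tt) , (true  , tt)) , a≢b) = ⊥-elim (a≢b refl)
  connected : ∀ (B : List (V 1)) → length B ≤ 0 → ∀ {x y} → x ∉ B → y ∉ B → Star (Avoid K₂ B) x y
  connected [] _ {false , tt} {false , tt} _ _ = ε
  connected [] _ {true  , tt} {true  , tt} _ _ = ε
  connected [] _ {false , tt} {true  , tt} _ _ = ((λ ()) , λ ()) ◅ ε
  connected [] _ {true  , tt} {false , tt} _ _ = ((λ ()) , λ ()) ◅ ε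

module _ {A : Set} {H : Graph A} {G : Graph (Bool × A)}
         (b : Bool) (embed : ∀ {x y} → H x y → G (b , x) (b , y)) where
  copyEdge : LV H → LV G
  copyEdge ((x , y) , h) = ((b , x) , (b , y)) , embed h

  copyEdge-reflects-≈ : ∀ e e′ → _≈E_ {G = G} (copyEdge e) (copyEdge e′) → _≈E_ {G = H} e e′
  copyEdge-reflects-≈ _ _ (inj₁ (p , q)) = inj₁ (cong proj₂ p , cong proj₂ q)
  copyEdge-reflects-≈ _ _ (inj₂ (p , q)) = inj₂ (cong proj₂ p , cong proj₂ q)

  copyEdge-preserves-≈ : ∀ e e′ → _≈E_ {G = H} e e′ → _≈E_ {G = G} (copyEdge e) (copyEdge e′)
  copyEdge-preserves-≈ _ _ (inj₁ (p , q)) = inj₁ (cong (b ,_) p , cong (b ,_) q)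
  copyEdge-preserves-≈ _ _ (inj₂ (p , q)) = inj₂ (cong (b ,_) p , cong (b ,_) q)

  liftPath : ∀ B {x y} → Star (Avoid H (half b B)) x y → Star (Avoid G B) (b , x) (b , y)
  liftPath B = gmap (b ,_) λ (h , y∉) → embed h , y∉ ∘′ ∈-half⁺ b B

length≡0⇒∉ : ∀ {A : Set} (xs : List A) → length xs ≡ 0 → ∀ {x} → x ∉ xs
length≡0⇒∉ [] _ ()

m≰n∧m+o≤1+n⇒o≡0 : ∀ {m n o} → ¬ m ≤ n → m + o ≤ suc n → o ≡ 0
m≰n∧m+o≤1+n⇒o≡0 {m} {n} {o} m≰n m+o≤1+n = ℕP.n≤0⇒n≡0 (ℕP.+-cancelˡ-≤ m o 0
  (ℕP.≤-trans m+o≤1+n (ℕP.≤-trans (ℕP.≰⇒> m≰n) (ℕP.≤-reflexive (sym (ℕP.+-identityʳ m))))))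

module ⊕-facts {m : ℕ} {G₁ G₂ : Graph (V (suc m))} (H₁ : HLFacts m G₁) (H₂ : HLFacts m G₂)
               (f : V (suc m) ⤖ V (suc m)) where
  private
    module H₁ = HLFacts H₁
    module H₂ = HLFacts H₂

    to : V (suc m) → V (suc m)
    to = Bijection.to f

    from : V (suc m) → V (suc m)
    from y = proj₁ (Bijection.surjective f y)

    to-from : ∀ y → to (from y) ≡ y
    to-from y = proj₂ (Bijection.surjective f y) refl

    to-injective : ∀ {x y} → to x ≡ to y → x ≡ y
    to-injective = Bijection.injective f

    G : Graph (V (suc (suc m)))
    G = ⊕ G₁ G₂ to

    _≈_ : LV G → LV G → Set
    _≈_ = _≈E_ {G = G}

  nbr : V (suc (suc m)) → Fin (suc (suc m)) → V (suc (suc m))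
  nbr (false , x) zero    = true , to x
  nbr (false , x) (suc i) = false , H₁.nbr x i
  nbr (true  , y) zero    = false , from y
  nbr (true  , y) (suc i) = true , H₂.nbr y i

  nbr-adjacent : ∀ v i → G v (nbr v i)
  nbr-adjacent (false , x) zero    = refl
  nbr-adjacent (false , x) (suc i) = H₁.nbr-adjacent x i
  nbr-adjacent (true  , y) zero    = to-from y
  nbr-adjacent (true  , y) (suc i) = H₂.nbr-adjacent y i

  nbr-injective : ∀ v {i j} → nbr v i ≡ nbr v j → i ≡ j
  nbr-injective (false , x) {zero}  {zero}  _  = refl
  nbr-injective (false , x) {suc i} {suc j} eq = cong suc (H₁.nbr-injective x (cong proj₂ eq))
  nbr-injective (true  , y) {zero}  {zero}  _  = refl
  nbr-injective (true  , y) {suc i} {suc j} eq = cong suc (H₂.nbr-injective y (cong proj₂ eq))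

  nbr-surjective : ∀ {v w} → G v w → ∃ λ i → nbr v i ≡ w
  nbr-surjective {false , x} {false , y} g =
    let i , eq = H₁.nbr-surjective g in suc i , cong (false ,_) eq
  nbr-surjective {false , x} {true  , y} g = zero , cong (true ,_) g
  nbr-surjective {true  , y} {false , x} g = zero , cong (false ,_) (to-injective (trans (to-from y) (sym g)))
  nbr-surjective {true  , x} {true  , y} g =
    let i , eq = H₂.nbr-surjective g in suc i , cong (true ,_) eq

  adj-sym : ∀ {a b} → G a b → G b a
  adj-sym {false , _} {false , _} g = H₁.adj-sym g
  adj-sym {false , _} {true  , _} g = g
  adj-sym {true  , _} {false , _} g = g
  adj-sym {true  , _} {true  , _} g = H₂.adj-sym g

  adj-irrefl : ∀ {a} → ¬ G a a
  adj-irrefl {false , _} = H₁.adj-irrefl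
  adj-irrefl {true  , _} = H₂.adj-irrefl

  private
    loop₁ : ∀ {x y} → x ≡ y → ¬ G₁ x y
    loop₁ refl = H₁.adj-irrefl
    loop₂ : ∀ {x y} → x ≡ y → ¬ G₂ x y
    loop₂ refl = H₂.adj-irrefl

  triangle-free : ∀ {a b c} → G a b → G b c → ¬ G a c
  triangle-free {false , _} {false , _} {false , _} p q r = H₁.triangle-free p q r
  triangle-free {true  , _} {true  , _} {true  , _} p q r = H₂.triangle-free p q r
  triangle-free {false , _} {false , _} {true  , _} p q r = loop₁ (to-injective (trans r (sym q))) p
  triangle-free {false , _} {true  , _} {false , _} p q r = loop₁ (to-injective (trans p (sym q))) r
  triangle-free {true  , _} {false , _} {false , _} p q r = loop₁ (to-injective (trans p (sym r))) q
  triangle-free {false , _} {true  , _} {true  , _} p q r = loop₂ (trans (sym p) r) q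
  triangle-free {true  , _} {false , _} {true  , _} p q r = loop₂ (trans (sym p) q) r
  triangle-free {true  , _} {true  , _} {false , _} p q r = loop₂ (trans (sym r) q) p


  private
    copy₁ : LV G₁ → LV G
    copy₁ = copyEdge false (λ g → g)
    copy₂ : LV G₂ → LV G
    copy₂ = copyEdge true (λ g → g)
    copy₁-reflects-≈ : ∀ e e′ → copy₁ e ≈ copy₁ e′ → _≈E_ {G = G₁} e e′
    copy₁-reflects-≈ = copyEdge-reflects-≈ {G = G} false (λ g → g)
    copy₂-reflects-≈ : ∀ e e′ → copy₂ e ≈ copy₂ e′ → _≈E_ {G = G₂} e e′
    copy₂-reflects-≈ = copyEdge-reflects-≈ {G = G} true (λ g → g)
    copy₁-preserves-≈ : ∀ e e′ → _≈E_ {G = G₁} e e′ → copy₁ e ≈ copy₁ e′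
    copy₁-preserves-≈ = copyEdge-preserves-≈ {G = G} false (λ g → g)
    copy₂-preserves-≈ : ∀ e e′ → _≈E_ {G = G₂} e e′ → copy₂ e ≈ copy₂ e′
    copy₂-preserves-≈ = copyEdge-preserves-≈ {G = G} true (λ g → g)

  crossEdge : V (suc m) → LV G
  crossEdge x = ((false , x) , (true , to x)) , refl

  edges : List (LV G)
  edges = map copy₁ H₁.edges ++ map copy₂ H₂.edges ++ map crossEdge (allV (suc m))

  length-edges : length edges ≡ suc (suc m) * 2 ^ suc m
  length-edges =
    trans (length-++ (map copy₁ H₁.edges))
          (trans (cong₂ _+_ length-copies₁ (trans (length-++ (map copy₂ H₂.edges))
                                                  (cong₂ _+_ length-copies₂ length-crosses)))
                 (count m (2 ^ m)))
    where
    length-copies₁ : length (map copy₁ H₁.edges) ≡ suc m * 2 ^ m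
    length-copies₁ = trans (length-map copy₁ H₁.edges) H₁.length-edges
    length-copies₂ : length (map copy₂ H₂.edges) ≡ suc m * 2 ^ m
    length-copies₂ = trans (length-map copy₂ H₂.edges) H₂.length-edges
    length-crosses : length (map crossEdge (allV (suc m))) ≡ 2 * 2 ^ m
    length-crosses = trans (length-map crossEdge (allV (suc m))) (length-allV (suc m))
    count : ∀ m k → suc m * k + (suc m * k + 2 * k) ≡ suc (suc m) * (2 * k)
    count = solve-∀

  private
    copy₁≉copy₂ : ∀ e e′ → ¬ copy₁ e ≈ copy₂ e′
    copy₁≉copy₂ _ _ (inj₁ (() , _))
    copy₁≉copy₂ _ _ (inj₂ (() , _))
    copy₁≉cross : ∀ e x → ¬ copy₁ e ≈ crossEdge x
    copy₁≉cross _ _ (inj₁ (_ , ()))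
    copy₁≉cross _ _ (inj₂ (() , _))
    copy₂≉cross : ∀ e x → ¬ copy₂ e ≈ crossEdge x
    copy₂≉cross _ _ (inj₁ (() , _))
    copy₂≉cross _ _ (inj₂ (_ , ()))
    cross-reflects-≈ : ∀ x y → crossEdge x ≈ crossEdge y → x ≡ y
    cross-reflects-≈ _ _ (inj₁ (p , _)) = cong proj₂ p
    cross-reflects-≈ _ _ (inj₂ (() , _))

    all-map : ∀ {B : Set} {P : LV G → Set} (g : B → LV G) {xs : List B} → (∀ x → P (g x)) → All P (map g xs)
    all-map g P-g = AllP.map⁺ (All.tabulate λ {x} _ → P-g x)

  edges-distinct : AllPairs (λ e e′ → ¬ e ≈ e′) edges
  edges-distinct = AllPairsP.++⁺
    (AllPairsP.map⁺ (AllPairs.map (λ {e} {e′} e≉ → e≉ ∘′ copy₁-reflects-≈ e e′) H₁.edges-distinct))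
    (AllPairsP.++⁺
      (AllPairsP.map⁺ (AllPairs.map (λ {e} {e′} e≉ → e≉ ∘′ copy₂-reflects-≈ e e′) H₂.edges-distinct))
      (AllPairsP.map⁺ (AllPairs.map (λ x≢y → x≢y ∘′ cross-reflects-≈ _ _) (allV-distinct (suc m))))
      (all-map copy₂ {H₂.edges} λ e → all-map crossEdge {allV (suc m)} (copy₂≉cross e)))
    (all-map copy₁ {H₁.edges} λ e → AllP.++⁺ (all-map copy₂ {H₂.edges} (copy₁≉copy₂ e))
                                             (all-map crossEdge {allV (suc m)} (copy₁≉cross e)))

  edges-complete : ∀ e → Any (e ≈_) edges
  edges-complete (((false , u) , (false , v)) , g) = AnyP.++⁺ˡ (AnyP.map⁺
    (Any.map (λ {e} → copy₁-preserves-≈ ((u , v) , g) e) (H₁.edges-complete ((u , v) , g))))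
  edges-complete (((true , u) , (true , v)) , g) = AnyP.++⁺ʳ (map copy₁ H₁.edges) (AnyP.++⁺ˡ (AnyP.map⁺
    (Any.map (λ {e} → copy₂-preserves-≈ ((u , v) , g) e) (H₂.edges-complete ((u , v) , g)))))
  edges-complete (((false , u) , (true , v)) , g) = AnyP.++⁺ʳ (map copy₁ H₁.edges) (AnyP.++⁺ʳ (map copy₂ H₂.edges)
    (AnyP.map⁺ {f = crossEdge} (Any.map (λ { refl → inj₁ (refl , cong (true ,_) (sym g)) }) (∈-allV (suc m) u))))
  edges-complete (((true , u) , (false , v)) , g) = AnyP.++⁺ʳ (map copy₁ H₁.edges) (AnyP.++⁺ʳ (map copy₂ H₂.edges)
    (AnyP.map⁺ {f = crossEdge} (Any.map (λ { refl → inj₂ (cong (true ,_) (sym g) , refl) }) (∈-allV (suc m) v))))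

  private
    inside₁ : ∀ B → length (half false B) ≤ m → ∀ {a b} → (false , a) ∉ B → (false , b) ∉ B →
              Star (Avoid G B) (false , a) (false , b)
    inside₁ B small a∉ b∉ =
      liftPath false (λ g → g) B (H₁.connected-avoiding _ small (a∉ ∘′ ∈-half⁻ false B) (b∉ ∘′ ∈-half⁻ false B))

    inside₂ : ∀ B → length (half true B) ≤ m → ∀ {a b} → (true , a) ∉ B → (true , b) ∉ B →
              Star (Avoid G B) (true , a) (true , b)
    inside₂ B small a∉ b∉ =
      liftPath true (λ g → g) B (H₂.connected-avoiding _ small (a∉ ∘′ ∈-half⁻ true B) (b∉ ∘′ ∈-half⁻ true B))

    missing-crossEdge : (B : List (V (suc (suc m)))) → length B ≤ suc m →
                        ∃ λ x → (false , x) ∉ B × (true , to x) ∉ B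
    missing-crossEdge B |B|≤ =
      let x , x∉ = missing-vertex (half false B ++ map from (half true B)) length≤
      in  x , (x∉ ∘′ ∈-++⁺ˡ ∘′ ∈-half⁺ false B)
            , (λ tox∈B → x∉ (∈-++⁺ʳ (half false B)
                 (subst (_∈ map from (half true B)) (to-injective (to-from (to x)))
                        (∈-map⁺ from (∈-half⁺ true B tox∈B)))))
      where
      length≤ : length (half false B ++ map from (half true B)) ≤ suc m
      length≤ = ℕP.≤-trans (ℕP.≤-reflexive (trans (length-++ (half false B))
                  (trans (cong (length (half false B) +_) (length-map from (half true B))) (length-halves B))))
                  |B|≤

    Hub : List (V (suc (suc m))) → Set
    Hub B = ∃ λ h → ∀ {v} → v ∉ B → Star (Avoid G B) v h

    hub-at-crossEdge : ∀ B → length B ≤ suc m → length (half false B) ≤ m → length (half true B) ≤ m → Hub B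
    hub-at-crossEdge B |B|≤ small₁ small₂ with missing-crossEdge B |B|≤
    ... | c , c∉₁ , c∉₂ = (false , c) , toHub
      where
      toHub : ∀ {v} → v ∉ B → Star (Avoid G B) v (false , c)
      toHub {false , a} a∉ = inside₁ B small₁ a∉ c∉₁
      toHub {true  , a} a∉ = inside₂ B small₂ a∉ c∉₂ ◅◅ ((refl , c∉₁) ◅ ε)

    hub-in-untouched₁ : ∀ B → length (half false B) ≡ 0 → V (suc m) → Hub B
    hub-in-untouched₁ B length≡0 x = (false , x) , toHub
      where
      small : length (half false B) ≤ m
      small = subst (_≤ m) (sym length≡0) z≤n
      untouched : ∀ t → (false , t) ∉ B
      untouched t = length≡0⇒∉ (half false B) length≡0 ∘′ ∈-half⁺ false B
      toHub : ∀ {v} → v ∉ B → Star (Avoid G B) v (false , x)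
      toHub {false , a} _ = inside₁ B small (untouched a) (untouched x)
      toHub {true  , a} _ = (to-from a , untouched (from a)) ◅ inside₁ B small (untouched (from a)) (untouched x)

    hub-in-untouched₂ : ∀ B → length (half true B) ≡ 0 → V (suc m) → Hub B
    hub-in-untouched₂ B length≡0 x = (true , x) , toHub
      where
      small : length (half true B) ≤ m
      small = subst (_≤ m) (sym length≡0) z≤n
      untouched : ∀ t → (true , t) ∉ B
      untouched t = length≡0⇒∉ (half true B) length≡0 ∘′ ∈-half⁺ true B
      toHub : ∀ {v} → v ∉ B → Star (Avoid G B) v (true , x)
      toHub {false , a} _ = (refl , untouched (to a)) ◅ inside₂ B small (untouched (to a)) (untouched x)
      toHub {true  , a} _ = inside₂ B small (untouched a) (untouched x)

    -- Removing at most m + 1 vertices leaves at most m in each copy, or one copy untouched.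
    hub : ∀ B → length B ≤ suc m → V (suc m) → Hub B
    hub B |B|≤ x with length (half false B) ≤? m | length (half true B) ≤? m
    ... | yes small₁ | yes small₂ = hub-at-crossEdge B |B|≤ small₁ small₂
    ... | no big₁    | _          = hub-in-untouched₂ B
      (m≰n∧m+o≤1+n⇒o≡0 big₁ (ℕP.≤-trans (ℕP.≤-reflexive (length-halves B)) |B|≤)) x
    ... | yes _      | no big₂    = hub-in-untouched₁ B
      (m≰n∧m+o≤1+n⇒o≡0 big₂
        (ℕP.≤-trans (ℕP.≤-reflexive (trans (ℕP.+-comm (length (half true B)) _) (length-halves B))) |B|≤)) x

  connected-avoiding : ∀ B → length B ≤ suc m → ∀ {x y} → x ∉ B → y ∉ B → Star (Avoid G B) x y
  connected-avoiding B |B|≤ {x} x∉ y∉ =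
    let h , toHub = hub B |B|≤ (proj₂ x) in toHub x∉ ◅◅ reverse-avoiding (λ {a} {b} → adj-sym {a} {b}) y∉ (toHub y∉)

  facts : HLFacts (suc m) G
  facts = record
    { nbr                = nbr
    ; nbr-adjacent       = nbr-adjacent
    ; nbr-injective      = nbr-injective
    ; nbr-surjective     = λ {v} {w} → nbr-surjective {v} {w}
    ; adj-sym            = λ {a} {b} → adj-sym {a} {b}
    ; adj-irrefl         = λ {a} → adj-irrefl {a}
    ; triangle-free      = λ {a} {b} {c} → triangle-free {a} {b} {c}
    ; edges              = edges
    ; length-edges       = length-edges
    ; edges-distinct     = edges-distinct
    ; edges-complete     = edges-complete
    ; connected-avoiding = connected-avoiding
    }

HL⇒facts : ∀ {m G} → HL (suc m) G → HLFacts m G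
HL⇒facts base           = K₂-facts
HL⇒facts (step h₁ h₂ f) = ⊕-facts.facts (HL⇒facts h₁) (HL⇒facts h₂) f

module LineGraph {A : Set} (_≟_ : DecidableEquality A) (G : Graph A) (S : List (LV G × LV G)) where

  -- _≈E_ computes on its arguments, so they could not be inferred from a proof of it;
  -- the record wrappers below keep them visible.
  record _≃_ (e e′ : LV G) : Set where
    constructor mk≃
    field un≃ : _≈E_ {G = G} e e′
  open _≃_ public

  infix 4 _≃_

  ≃-refl : ∀ {e} → e ≃ e
  ≃-refl = mk≃ (inj₁ (refl , refl))

  ≃-sym : ∀ {e e′} → e ≃ e′ → e′ ≃ e
  ≃-sym (mk≃ (inj₁ (p , q))) = mk≃ (inj₁ (sym p , sym q))
  ≃-sym (mk≃ (inj₂ (p , q))) = mk≃ (inj₂ (sym q , sym p))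

  ≃-trans : ∀ {e e′ e″} → e ≃ e′ → e′ ≃ e″ → e ≃ e″
  ≃-trans (mk≃ (inj₁ (p , q))) (mk≃ (inj₁ (r , s))) = mk≃ (inj₁ (trans p r , trans q s))
  ≃-trans (mk≃ (inj₁ (p , q))) (mk≃ (inj₂ (r , s))) = mk≃ (inj₂ (trans p r , trans q s))
  ≃-trans (mk≃ (inj₂ (p , q))) (mk≃ (inj₁ (r , s))) = mk≃ (inj₂ (trans p s , trans q r))
  ≃-trans (mk≃ (inj₂ (p , q))) (mk≃ (inj₂ (r , s))) = mk≃ (inj₁ (trans p s , trans q r))

  ≈E? : ∀ e e′ → Dec (_≈E_ {G = G} e e′)
  ≈E? ((u , v) , _) ((u′ , v′) , _) = ((u ≟ u′) ×-dec (v ≟ v′)) ⊎-dec ((u ≟ v′) ×-dec (v ≟ u′))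

  _≃?_ : ∀ e e′ → Dec (e ≃ e′)
  e ≃? e′ = map′ mk≃ un≃ (≈E? e e′)

  Cut : LV G → LV G → Set
  Cut = InS {G = G} S

  Cut? : ∀ e e′ → Dec (Cut e e′)
  Cut? e e′ = map′ find (λ (st , st∈S , match) → lose st∈S match) (Any.any? matches? S)
    where
    matches? : ∀ st → Dec (_ ⊎ _)
    matches? (s , t) = (≈E? e s ×-dec ≈E? e′ t) ⊎-dec (≈E? e t ×-dec ≈E? e′ s)

  Cut-sym : ∀ {e e′} → Cut e e′ → Cut e′ e
  Cut-sym (st , st∈S , inj₁ (p , q)) = st , st∈S , inj₂ (q , p)
  Cut-sym (st , st∈S , inj₂ (p , q)) = st , st∈S , inj₁ (q , p)

  Cut-resp : ∀ {e₁ e₁′ e₂ e₂′} → e₁ ≃ e₁′ → e₂ ≃ e₂′ → Cut e₁ e₂ → Cut e₁′ e₂′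
  Cut-resp {e₁} {_} {e₂} e₁≃ e₂≃ ((s , t) , st∈S , inj₁ (p , q)) =
    (s , t) , st∈S , inj₁ (un≃ (≃-trans (≃-sym e₁≃) (mk≃ {e₁} {s} p)) , un≃ (≃-trans (≃-sym e₂≃) (mk≃ {e₂} {t} q)))
  Cut-resp {e₁} {_} {e₂} e₁≃ e₂≃ ((s , t) , st∈S , inj₂ (p , q)) =
    (s , t) , st∈S , inj₂ (un≃ (≃-trans (≃-sym e₁≃) (mk≃ {e₁} {t} p)) , un≃ (≃-trans (≃-sym e₂≃) (mk≃ {e₂} {s} q)))

  Shares : LV G → LV G → Set
  Shares ((u , v) , _) ((u′ , v′) , _) = (u ≡ u′ ⊎ u ≡ v′) ⊎ (v ≡ u′ ⊎ v ≡ v′)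

  Adj : LV G → LV G → Set
  Adj = LAdj G

  Adj? : ∀ e e′ → Dec (Adj e e′)
  Adj? e@((u , v) , _) e′@((u′ , v′) , _) =
    ¬? (≈E? e e′) ×-dec (((u ≟ u′) ⊎-dec (u ≟ v′)) ⊎-dec ((v ≟ u′) ⊎-dec (v ≟ v′)))

  Adj-resp : ∀ {e₁ e₁′ e₂ e₂′} → e₁ ≃ e₁′ → e₂ ≃ e₂′ → Adj e₁ e₂ → Adj e₁′ e₂′
  Adj-resp {e₁} {e₁′} {e₂} {e₂′} e₁≃ e₂≃ (e₁≉e₂ , share) =
    (λ e₁′≈e₂′ → e₁≉e₂ (un≃ (≃-trans e₁≃ (≃-trans (mk≃ {e₁′} {e₂′} e₁′≈e₂′) (≃-sym e₂≃))))) ,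
    reorient₂ {e₁′} e₂≃ (reorient₁ {f = e₂} e₁≃ share)
    where
    reorient₁ : ∀ {e e′ f} → e ≃ e′ → Shares e f → Shares e′ f
    reorient₁ (mk≃ (inj₁ (refl , refl))) = λ share → share
    reorient₁ (mk≃ (inj₂ (refl , refl))) = Sum.swap
    reorient₂ : ∀ {e f f′} → f ≃ f′ → Shares e f → Shares e f′
    reorient₂ (mk≃ (inj₁ (refl , refl))) = λ share → share
    reorient₂ (mk≃ (inj₂ (refl , refl))) = Sum.map Sum.swap Sum.swap

  Adj-sym : ∀ {e e′} → Adj e e′ → Adj e′ e
  Adj-sym {e} {e′} (e≉e′ , share) = (λ e′≈e → e≉e′ (un≃ (≃-sym (mk≃ {e′} {e} e′≈e)))) , flip share
    where
    flip : Shares e e′ → Shares e′ e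
    flip (inj₁ (inj₁ p)) = inj₁ (inj₁ (sym p))
    flip (inj₁ (inj₂ p)) = inj₂ (inj₁ (sym p))
    flip (inj₂ (inj₁ p)) = inj₁ (inj₂ (sym p))
    flip (inj₂ (inj₂ p)) = inj₂ (inj₂ (sym p))

  record Linked (e e′ : LV G) : Set where
    constructor mkLinked
    field unLinked : LminusAdj G S e e′
  open Linked public

  Linked? : ∀ e e′ → Dec (Linked e e′)
  Linked? e e′ = map′ mkLinked unLinked (Adj? e e′ ×-dec ¬? (Cut? e e′))

  Linked-resp : ∀ {e₁ e₁′ e₂ e₂′} → e₁ ≃ e₁′ → e₂ ≃ e₂′ → Linked e₁ e₂ → Linked e₁′ e₂′
  Linked-resp e₁≃ e₂≃ (mkLinked (adj , ¬cut)) =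
    mkLinked (Adj-resp e₁≃ e₂≃ adj , ¬cut ∘′ Cut-resp (≃-sym e₁≃) (≃-sym e₂≃))

  Linked-sym : ∀ {e e′} → Linked e e′ → Linked e′ e
  Linked-sym {e} {e′} (mkLinked (adj , ¬cut)) = mkLinked (Adj-sym {e} {e′} adj , ¬cut ∘′ Cut-sym {e′} {e})

  without : LV G → List (LV G) → List (LV G)
  without x = filter (λ e → ¬? (e ≃? x))

  ∈-without⁻ : ∀ x {xs e} → e ∈ without x xs → e ∈ xs × ¬ e ≃ x
  ∈-without⁻ x {xs} = ∈-filter⁻ (λ e → ¬? (e ≃? x)) {xs = xs}

  without-distinct : ∀ x {xs} → AllPairs (λ e e′ → ¬ _≈E_ {G = G} e e′) xs →
                     AllPairs (λ e e′ → ¬ _≈E_ {G = G} e e′) (without x xs)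
  without-distinct x = AllPairsP.filter⁺ (λ e → ¬? (e ≃? x))

  -- x is equivalent to at most one member of a list of pairwise inequivalent edges
  length-without : ∀ x {xs} → AllPairs (λ e e′ → ¬ _≈E_ {G = G} e e′) xs → length xs ≤ suc (length (without x xs))
  length-without x {[]}     []                 = z≤n
  length-without x {e ∷ xs} (e≉xs ∷ xs-distinct) with e ≃? x
  ... | yes e≃x = s≤s (ℕP.≤-reflexive (cong length (begin
    xs                 ≡⟨ filter-all ≄x? (All.map (λ e≉e′ e′≃x → e≉e′ (un≃ (≃-trans e≃x (≃-sym e′≃x)))) e≉xs) ⟨
    without x xs       ≡⟨ filter-reject ≄x? (λ e≄x → e≄x e≃x) ⟨
    without x (e ∷ xs) ∎)))
    where
    ≄x? = λ e → ¬? (e ≃? x)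
    open ≡-Reasoning
  ... | no e≄x  = subst (λ l → suc (length xs) ≤ suc (length l)) (sym (filter-accept (λ e → ¬? (e ≃? x)) e≄x))
                        (s≤s (length-without x xs-distinct))

  Joined : LV G → LV G → Set
  Joined e e′ = ∃₂ λ f f′ → e ≃ f × e′ ≃ f′ × Star Linked f f′

  Joined-≃ : ∀ {e e′} → e ≃ e′ → Joined e e′
  Joined-≃ {e} e≃e′ = e , e , ≃-refl , ≃-sym e≃e′ , ε

  Joined-refl : ∀ e → Joined e e
  Joined-refl e = Joined-≃ (≃-refl {e})

  Joined-linked : ∀ {e e′ e″} → Joined e e′ → Linked e′ e″ → Joined e e″
  Joined-linked (f , f′ , e≃f , e′≃f′ , path) link =
    f , _ , e≃f , ≃-refl , path ◅◅ (Linked-resp e′≃f′ ≃-refl link ◅ ε)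

  Joined-≃ʳ : ∀ {e e′ e″} → Joined e e′ → e′ ≃ e″ → Joined e e″
  Joined-≃ʳ (f , f′ , e≃f , e′≃f′ , path) e′≃e″ = f , f′ , e≃f , ≃-trans (≃-sym e′≃e″) e′≃f′ , path

  Joined-trans : ∀ {e e′ e″} → Joined e e′ → Joined e′ e″ → Joined e e″
  Joined-trans (f , f′ , e≃f , e′≃f′ , path) (g , g′ , e′≃g , e″≃g′ , ε) =
    f , f′ , e≃f , ≃-trans e″≃g′ (≃-trans (≃-sym e′≃g) e′≃f′) , path
  Joined-trans (f , f′ , e≃f , e′≃f′ , path) (g , g′ , e′≃g , e″≃g′ , link ◅ path′) =
    f , g′ , e≃f , e″≃g′ , path ◅◅ (Linked-resp (≃-trans (≃-sym e′≃g) e′≃f′) ≃-refl link ◅ path′)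

  private
    restart : ∀ {e f f′} → e ≃ f → Star Linked f f′ → Star Linked e f′ ⊎ e ≃ f′
    restart e≃f ε             = inj₂ e≃f
    restart e≃f (link ◅ path) = inj₁ (Linked-resp (≃-sym e≃f) ≃-refl link ◅ path)

  Joined⇒path : ∀ {e e′} → Joined e e′ → Star Linked e e′ ⊎ e ≃ e′
  Joined⇒path (f , f′ , e≃f , e′≃f′ , path) with restart e≃f path
  ... | inj₂ e≃f′  = inj₂ (≃-trans e≃f′ (≃-sym e′≃f′))
  ... | inj₁ path′ with restart e′≃f′ (Star.reverse Linked-sym path′)
  ...   | inj₁ path″ = inj₁ (Star.reverse Linked-sym path″)
  ...   | inj₂ e′≃e  = inj₂ (≃-sym e′≃e)

module Cliques {M : ℕ} {G : Graph (V (suc M))} (H : HLFacts M G) (S : List (LV G × LV G)) where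
  open HLFacts H public
  open LineGraph _≟V_ G S public

  Vertex : Set
  Vertex = V (suc M)

  Index : Set
  Index = Fin (suc M)

  adjacent⇒≢ : ∀ {x y} → G x y → x ≢ y
  adjacent⇒≢ g refl = adj-irrefl g

  edgeAt : Vertex → Index → LV G
  edgeAt v i = (v , nbr v i) , nbr-adjacent v i

  edgeAt-≃ : ∀ {v w i j} → edgeAt v i ≃ edgeAt w j → (v ≡ w × i ≡ j) ⊎ (v ≡ nbr w j × nbr v i ≡ w)
  edgeAt-≃ {v} (mk≃ (inj₁ (refl , q))) = inj₁ (refl , nbr-injective v q)
  edgeAt-≃     (mk≃ (inj₂ (p , q)))    = inj₂ (p , q)

  edgeAt-≄ : ∀ v {i j} → i ≢ j → ¬ edgeAt v i ≃ edgeAt v j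
  edgeAt-≄ v i≢j e≃ with edgeAt-≃ e≃
  ... | inj₁ (_ , i≡j)   = i≢j i≡j
  ... | inj₂ (v≡nbr , _) = adjacent⇒≢ (nbr-adjacent v _) v≡nbr

  edgeAt-adjacent : ∀ v {i j} → i ≢ j → Adj (edgeAt v i) (edgeAt v j)
  edgeAt-adjacent v i≢j = (λ e≈ → edgeAt-≄ v i≢j (mk≃ e≈)) , inj₁ (inj₁ refl)

  edgeAt-pair-≃ : ∀ {v w i j k l} → i ≢ k → edgeAt v i ≃ edgeAt w j → edgeAt v k ≃ edgeAt w l →
                  v ≡ w × i ≡ j × k ≡ l
  edgeAt-pair-≃ {v} {w} {j = j} {l = l} i≢k p q with edgeAt-≃ p | edgeAt-≃ q
  ... | inj₁ (v≡w , i≡j) | inj₁ (_ , k≡l)    = v≡w , i≡j , k≡l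
  ... | inj₁ (refl , _)  | inj₂ (v≡nbr , _)  = ⊥-elim (adjacent⇒≢ (nbr-adjacent w l) v≡nbr)
  ... | inj₂ (v≡nbr , _) | inj₁ (refl , _)   = ⊥-elim (adjacent⇒≢ (nbr-adjacent w j) v≡nbr)
  ... | inj₂ (_ , nbr≡w) | inj₂ (_ , nbr≡w′) = ⊥-elim (i≢k (nbr-injective v (trans nbr≡w (sym nbr≡w′))))

  Endpoint : LV G → Vertex → Set
  Endpoint ((x , y) , _) z = x ≡ z ⊎ y ≡ z

  edgeAt-endpoint : ∀ e {z} → Endpoint e z → ∃ λ i → edgeAt z i ≃ e
  edgeAt-endpoint ((x , y) , g) (inj₁ refl) =
    let i , nbr-i≡y = nbr-surjective g in i , mk≃ (inj₁ (refl , nbr-i≡y))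
  edgeAt-endpoint ((x , y) , g) (inj₂ refl) =
    let j , nbr-j≡x = nbr-surjective (adj-sym g) in j , mk≃ (inj₂ (refl , nbr-j≡x))

  record CutPair : Set where
    constructor cutPair
    field
      centre    : Vertex
      one other : Index
      one≢other : one ≢ other
      cut       : Cut (edgeAt centre one) (edgeAt centre other)
  open CutPair public

  SameCutPair : CutPair → CutPair → Set
  SameCutPair c d = centre c ≡ centre d ×
    ((one c ≡ one d × other c ≡ other d) ⊎ (one c ≡ other d × other c ≡ one d))

  SameCutPair-sym : ∀ {c d} → SameCutPair c d → SameCutPair d c
  SameCutPair-sym (refl , inj₁ (refl , refl)) = refl , inj₁ (refl , refl)
  SameCutPair-sym (refl , inj₂ (refl , refl)) = refl , inj₂ (refl , refl)

  private
    Matches : LV G × LV G → LV G → LV G → Set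
    Matches (s , t) e e′ = (e ≃ s × e′ ≃ t) ⊎ (e ≃ t × e′ ≃ s)

    matches : ∀ {e e′} → (cut : Cut e e′) → Matches (proj₁ cut) e e′
    matches {e} {e′} ((s , t) , _ , inj₁ (p , q)) = inj₁ (mk≃ {e} {s} p , mk≃ {e′} {t} q)
    matches {e} {e′} ((s , t) , _ , inj₂ (p , q)) = inj₂ (mk≃ {e} {t} p , mk≃ {e′} {s} q)

    same-entry : ∀ {st e₁ e₂ f₁ f₂} → Matches st e₁ e₂ → Matches st f₁ f₂ →
                 (e₁ ≃ f₁ × e₂ ≃ f₂) ⊎ (e₁ ≃ f₂ × e₂ ≃ f₁)
    same-entry (inj₁ (p , q)) (inj₁ (r , s)) = inj₁ (≃-trans p (≃-sym r) , ≃-trans q (≃-sym s))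
    same-entry (inj₁ (p , q)) (inj₂ (r , s)) = inj₂ (≃-trans p (≃-sym s) , ≃-trans q (≃-sym r))
    same-entry (inj₂ (p , q)) (inj₁ (r , s)) = inj₂ (≃-trans p (≃-sym s) , ≃-trans q (≃-sym r))
    same-entry (inj₂ (p , q)) (inj₂ (r , s)) = inj₁ (≃-trans p (≃-sym r) , ≃-trans q (≃-sym s))

  same-entry⇒SameCutPair : ∀ c d → proj₁ (cut c) ≡ proj₁ (cut d) → SameCutPair c d
  same-entry⇒SameCutPair c d same
    with same-entry (matches (cut c)) (subst (λ st → Matches st _ _) (sym same) (matches (cut d)))
  ... | inj₁ (p , q) = let v≡w , i≡j , k≡l = edgeAt-pair-≃ (one≢other c) p q in v≡w , inj₁ (i≡j , k≡l)
  ... | inj₂ (p , q) = let v≡w , i≡l , k≡j = edgeAt-pair-≃ (one≢other c) p q in v≡w , inj₂ (i≡l , k≡j)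

  length-cutPairs≤ : (cps : List CutPair) → AllPairs (λ c d → ¬ SameCutPair c d) cps → length cps ≤ length S
  length-cutPairs≤ cps distinct = injection⇒≤length S (λ x → proj₁ (cut (lookup cps x)))
    (λ x → proj₁ (proj₂ (cut (lookup cps x))))
    (λ {x} {y} same → lookup-injective-up-to SameCutPair (λ {c} {d} → SameCutPair-sym {c} {d}) distinct
                        (same-entry⇒SameCutPair (lookup cps x) (lookup cps y) same))

  Split : Vertex → Set
  Split v = ∃₂ λ i j → i ≢ j × Cut (edgeAt v i) (edgeAt v j) ×
    (∀ l → l ≢ i → l ≢ j → Cut (edgeAt v i) (edgeAt v l) ⊎ Cut (edgeAt v l) (edgeAt v j))

  Split? : ∀ v → Dec (Split v)
  Split? v = FinP.any? λ i → FinP.any? λ j →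
    ¬? (i Fin.≟ j) ×-dec Cut? (edgeAt v i) (edgeAt v j) ×-dec FinP.all? (λ l →
      ¬? (l Fin.≟ i) →-dec ¬? (l Fin.≟ j) →-dec (Cut? (edgeAt v i) (edgeAt v l) ⊎-dec Cut? (edgeAt v l) (edgeAt v j)))

  -- If the edge from i to j is cut, an unsplit vertex offers a detour through some third edge l.
  joined-at-unsplit : ∀ v → ¬ Split v → ∀ i j → Joined (edgeAt v i) (edgeAt v j)
  joined-at-unsplit v unsplit i j with i Fin.≟ j
  ... | yes refl = Joined-refl (edgeAt v i)
  ... | no i≢j with Cut? (edgeAt v i) (edgeAt v j)
  ...   | no uncut =
    Joined-linked {e″ = edgeAt v j} (Joined-refl (edgeAt v i)) (mkLinked (edgeAt-adjacent v i≢j , uncut))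
  ...   | yes cut-ij with FinP.any? (λ l → ¬? (l Fin.≟ i) ×-dec ¬? (l Fin.≟ j) ×-dec
                                        ¬? (Cut? (edgeAt v i) (edgeAt v l)) ×-dec ¬? (Cut? (edgeAt v l) (edgeAt v j)))
  ...     | yes (l , l≢i , l≢j , uncut-il , uncut-lj) =
    Joined-linked {e′ = edgeAt v l}
      (Joined-linked (Joined-refl (edgeAt v i)) (mkLinked (edgeAt-adjacent v (l≢i ∘′ sym) , uncut-il)))
      (mkLinked (edgeAt-adjacent v l≢j , uncut-lj))
  ...     | no no-detour = ⊥-elim (unsplit (i , j , i≢j , cut-ij , forced))
    where
    forced : ∀ l → l ≢ i → l ≢ j → Cut (edgeAt v i) (edgeAt v l) ⊎ Cut (edgeAt v l) (edgeAt v j)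
    forced l l≢i l≢j with Cut? (edgeAt v i) (edgeAt v l) | Cut? (edgeAt v l) (edgeAt v j)
    ... | yes cut-il | _          = inj₁ cut-il
    ... | no _       | yes cut-lj = inj₂ cut-lj
    ... | no uncut₁  | no uncut₂  = ⊥-elim (no-detour (l , l≢i , l≢j , uncut₁ , uncut₂))

  -- The M spokes p ≠ i at a split vertex each carry a cut pair, {i , p} or {p , j}, from which p can
  -- be recovered; so a split vertex accounts for M distinct cut pairs.
  private
    Through : Index → Index → Index → Index → Index → Set
    Through i j p x y = (x ≡ i × y ≡ p) ⊎ (x ≡ p × y ≡ j × p ≢ j)

    through-unique : ∀ {i j p p′ x y x′ y′} → i ≢ j → p ≢ i → p′ ≢ i →
                     Through i j p x y → Through i j p′ x′ y′ → (x ≡ x′ × y ≡ y′) ⊎ (x ≡ y′ × y ≡ x′) → p ≡ p′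
    through-unique _   _   _    (inj₁ (refl , refl))      (inj₁ (refl , refl))     (inj₁ (_ , p≡p′)) = p≡p′
    through-unique _   p≢i _    (inj₁ (refl , refl))      (inj₁ (refl , refl))     (inj₂ (_ , p≡i))  = ⊥-elim (p≢i p≡i)
    through-unique _   _   p′≢i (inj₁ (refl , refl))      (inj₂ (refl , refl , _)) (inj₁ (i≡p′ , _)) = ⊥-elim (p′≢i (sym i≡p′))
    through-unique i≢j _   _    (inj₁ (refl , refl))      (inj₂ (refl , refl , _)) (inj₂ (i≡j , _))  = ⊥-elim (i≢j i≡j)
    through-unique _   p≢i _    (inj₂ (refl , refl , _))  (inj₁ (refl , refl))     (inj₁ (p≡i , _))  = ⊥-elim (p≢i p≡i)
    through-unique _   _   _    (inj₂ (refl , refl , _))  (inj₁ (refl , refl))     (inj₂ (p≡p′ , _)) = p≡p′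
    through-unique _   _   _    (inj₂ (refl , refl , _))  (inj₂ (refl , refl , _)) (inj₁ (p≡p′ , _)) = p≡p′
    through-unique _   _   _    (inj₂ (refl , refl , p≢j)) (inj₂ (refl , refl , _)) (inj₂ (p≡j , _)) = ⊥-elim (p≢j p≡j)

    spoke : ∀ {v} (s : Split v) (l : Fin M) → let i , j , _ = s in
            ∃₂ λ x y → x ≢ y × Cut (edgeAt v x) (edgeAt v y) × Through i j (punchIn i l) x y
    spoke (i , j , i≢j , cut-ij , forced) l with punchIn i l Fin.≟ j
    ... | yes refl = i , punchIn i l , i≢j , cut-ij , inj₁ (refl , refl)
    ... | no p≢j with forced (punchIn i l) (FinP.punchInᵢ≢i i l) p≢j
    ...   | inj₁ cut-ip = i , punchIn i l , FinP.punchInᵢ≢i i l ∘′ sym , cut-ip , inj₁ (refl , refl)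
    ...   | inj₂ cut-pj = punchIn i l , j , p≢j , cut-pj , inj₂ (refl , refl , p≢j)

  splitCutPairs : ∀ v → Split v → List CutPair
  splitCutPairs v s = tabulate λ l → let x , y , x≢y , cut-xy , _ = spoke s l in cutPair v x y x≢y cut-xy

  length-splitCutPairs : ∀ v s → length (splitCutPairs v s) ≡ M
  length-splitCutPairs v s = length-tabulate _

  centre-splitCutPairs : ∀ v s → All (λ c → centre c ≡ v) (splitCutPairs v s)
  centre-splitCutPairs v s = AllP.tabulate⁺ λ _ → refl

  splitCutPairs-distinct : ∀ v s → AllPairs (λ c d → ¬ SameCutPair c d) (splitCutPairs v s)
  splitCutPairs-distinct v s@(i , j , i≢j , _) = AllPairsP.tabulate⁺ λ {l} {l′} l≢l′ (_ , same-indices) →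
    l≢l′ (FinP.punchIn-injective i l l′
      (through-unique i≢j (FinP.punchInᵢ≢i i l) (FinP.punchInᵢ≢i i l′)
                      (proj₂ (proj₂ (proj₂ (proj₂ (spoke s l)))))
                      (proj₂ (proj₂ (proj₂ (proj₂ (spoke s l′))))) same-indices))

  cutPairsOf : (B : List Vertex) → All Split B → List CutPair
  cutPairsOf []      []       = []
  cutPairsOf (v ∷ B) (s ∷ ss) = splitCutPairs v s ++ cutPairsOf B ss

  length-cutPairsOf : ∀ B ss → length (cutPairsOf B ss) ≡ length B * M
  length-cutPairsOf []      []       = refl
  length-cutPairsOf (v ∷ B) (s ∷ ss) =
    trans (length-++ (splitCutPairs v s)) (cong₂ _+_ (length-splitCutPairs v s) (length-cutPairsOf B ss))

  centre-cutPairsOf : ∀ B ss → All (λ c → centre c ∈ B) (cutPairsOf B ss)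
  centre-cutPairsOf []      []       = []
  centre-cutPairsOf (v ∷ B) (s ∷ ss) = AllP.++⁺
    (All.map (λ { refl → here refl }) (centre-splitCutPairs v s))
    (All.map there (centre-cutPairsOf B ss))

  cutPairsOf-distinct : ∀ B ss → AllPairs _≢_ B → AllPairs (λ c d → ¬ SameCutPair c d) (cutPairsOf B ss)
  cutPairsOf-distinct []      []       _                 = []
  cutPairsOf-distinct (v ∷ B) (s ∷ ss) (v≢B ∷ B-distinct) = AllPairsP.++⁺
    (splitCutPairs-distinct v s) (cutPairsOf-distinct B ss B-distinct) apart
    where
    apart : All (λ c → All (λ d → ¬ SameCutPair c d) (cutPairsOf B ss)) (splitCutPairs v s)
    apart = All-across (λ { refl centre∈B (same-centre , _) →
                            All.lookup v≢B (subst (_∈ B) (sym same-centre) centre∈B) refl })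
                       (centre-splitCutPairs v s) (centre-cutPairsOf B ss)

  -- abstract: normalising the filter would unfold every decision procedure above
  abstract
    splitVertices : List Vertex
    splitVertices = filter Split? (allV (suc M))

    splitVertices-distinct : AllPairs _≢_ splitVertices
    splitVertices-distinct = AllPairsP.filter⁺ Split? (allV-distinct (suc M))

    ∈-splitVertices⁻ : ∀ {v} → v ∈ splitVertices → Split v
    ∈-splitVertices⁻ v∈ = proj₂ (∈-filter⁻ Split? {xs = allV (suc M)} v∈)

    ∉-splitVertices⁻ : ∀ {v} → v ∉ splitVertices → ¬ Split v
    ∉-splitVertices⁻ {v} v∉ split = v∉ (∈-filter⁺ Split? (∈-allV (suc M) v) split)

  length-splitVertices*M≤ : length splitVertices * M ≤ length S
  length-splitVertices*M≤ = subst (_≤ length S) (length-cutPairsOf splitVertices splits)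
    (length-cutPairs≤ _ (cutPairsOf-distinct splitVertices splits splitVertices-distinct))
    where
    splits : All Split splitVertices
    splits = All.tabulate ∈-splitVertices⁻

  module Spokes (v : Vertex) (i : Index) {K : ℕ} (others : Fin K → Index)
           (others-injective : ∀ {t t′} → others t ≡ others t′ → t ≡ t′) (others≢i : ∀ t → others t ≢ i)
           (cuts : ∀ t → Cut (edgeAt v i) (edgeAt v (others t))) where
    cutPairs : List CutPair
    cutPairs = tabulate λ t → cutPair v i (others t) (others≢i t ∘′ sym) (cuts t)

    length-cutPairs : length cutPairs ≡ K
    length-cutPairs = length-tabulate _

    cutPairs-distinct : AllPairs (λ c d → ¬ SameCutPair c d) cutPairs
    cutPairs-distinct = AllPairsP.tabulate⁺ λ where
      t≢t′ (_ , inj₁ (_ , same-other)) → t≢t′ (others-injective same-other)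
      {t} {t′} _ (_ , inj₂ (i≡other , _)) → others≢i t′ (sym i≡other)

    centre-cutPairs : All (λ c → centre c ≡ v) cutPairs
    centre-cutPairs = AllP.tabulate⁺ λ _ → refl

    shape-cutPairs : All (λ c → one c ≡ i × ∃ λ t → other c ≡ others t) cutPairs
    shape-cutPairs = AllP.tabulate⁺ λ t → refl , t , refl

  apart-by-centre : ∀ {x cs ds} → All (λ c → centre c ≡ x) cs → All (λ d → centre d ≢ x) ds →
                    All (λ c → All (λ d → ¬ SameCutPair c d) ds) cs
  apart-by-centre = All-across λ { refl centre≢ (same-centre , _) → centre≢ (sym same-centre) }

split-count-bound : ∀ b m → b * suc (suc m) + 7 ≤ 4 * suc (suc (suc m)) → b ≤ 3 × b ≤ suc (suc m)
split-count-bound 0       m       _ = z≤n , z≤n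
split-count-bound 1       m       _ = s≤s z≤n , s≤s z≤n
split-count-bound 2       m       _ = s≤s (s≤s z≤n) , s≤s (s≤s z≤n)
split-count-bound 3       zero    h = ⊥-elim (ℕP.≤⇒≯ h (ℕP.n<1+n 12))
split-count-bound 3       (suc m) _ = s≤s (s≤s (s≤s z≤n)) , s≤s (s≤s (s≤s z≤n))
split-count-bound (suc (suc (suc (suc b)))) m h = ⊥-elim (ℕP.≤⇒≯
  (ℕP.+-cancelˡ-≤ (4 * (3 + m)) _ 0 (subst₂ _≤_ (expand b m) (sym (ℕP.+-identityʳ _)) h)) (s≤s z≤n))
  where
  expand : ∀ b m → (4 + b) * (2 + m) + 7 ≡ 4 * (3 + m) + (3 + b * (2 + m))
  expand = solve-∀

module LargeComponent {k : ℕ} {G : Graph (V (suc (suc (suc k))))} (H : HLFacts (suc (suc k)) G)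
                (S : List (LV G × LV G)) (|S|+7≤4n : length S + 7 ≤ 4 * suc (suc (suc k))) where
  open Cliques H S
  open DecMembership (_≟V_ {suc (suc (suc k))}) using (_∈?_)

  B : List Vertex
  B = splitVertices

  few-split : length B ≤ 3 × length B ≤ suc (suc k)
  few-split = split-count-bound (length B) k (ℕP.≤-trans (ℕP.+-monoˡ-≤ 7 length-splitVertices*M≤) |S|+7≤4n)

  no-four-split : ∀ {a b c d} → AllPairs _≢_ (a ∷ b ∷ c ∷ d ∷ []) → All (_∈ B) (a ∷ b ∷ c ∷ d ∷ []) → ⊥
  no-four-split distinct ⊆B = ℕP.<⇒≱ (s≤s (proj₁ few-split)) (distinct-⊆⇒≤length distinct ⊆B)

  abstract
    anchor : ∃ λ x → x ∉ B
    anchor = missing-vertex B (ℕP.m≤n⇒m≤1+n (proj₂ few-split))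

  c₀ : LV G
  c₀ = edgeAt (proj₁ anchor) zero

  Reached : Vertex → Set
  Reached v = ∀ i → Joined c₀ (edgeAt v i)

  reached-step : ∀ {y z} → G y z → z ∉ B → Reached y → Reached z
  reached-step {y} {z} g z∉B reached-y l =
    let i , nbr-i≡z = nbr-surjective g
        j , nbr-j≡y = nbr-surjective (adj-sym g)
    in Joined-trans (Joined-≃ʳ (reached-y i) (mk≃ (inj₂ (sym nbr-j≡y , nbr-i≡z))))
                    (joined-at-unsplit z (∉-splitVertices⁻ z∉B) j l)

  reached-path : ∀ {y z} → Star (Avoid G B) y z → Reached y → Reached z
  reached-path ε                   = λ reached → reached
  reached-path ((g , z∉B) ◅ path) = reached-path path ∘′ reached-step g z∉B

  reached-unsplit : ∀ {v} → v ∉ B → Reached v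
  reached-unsplit v∉B = reached-path (connected-avoiding B (proj₂ few-split) (proj₂ anchor) v∉B)
    (joined-at-unsplit (proj₁ anchor) (∉-splitVertices⁻ (proj₂ anchor)) zero)

  HasUnsplitEnd : LV G → Set
  HasUnsplitEnd ((x , y) , _) = x ∉ B ⊎ y ∉ B

  HasUnsplitEnd? : ∀ e → Dec (HasUnsplitEnd e)
  HasUnsplitEnd? ((x , y) , _) = ¬? (x ∈? B) ⊎-dec ¬? (y ∈? B)

  HasUnsplitEnd-resp : ∀ {e e′} → e ≃ e′ → HasUnsplitEnd e → HasUnsplitEnd e′
  HasUnsplitEnd-resp (mk≃ (inj₁ (refl , refl))) = λ unsplit → unsplit
  HasUnsplitEnd-resp (mk≃ (inj₂ (refl , refl))) = Sum.swap

  joined-unsplitEnd : ∀ e → HasUnsplitEnd e → Joined c₀ e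
  joined-unsplitEnd ((x , y) , g) (inj₁ x∉B) =
    let i , nbr-i≡y = nbr-surjective g in Joined-≃ʳ (reached-unsplit x∉B i) (mk≃ (inj₁ (refl , nbr-i≡y)))
  joined-unsplitEnd ((x , y) , g) (inj₂ y∉B) =
    let j , nbr-j≡x = nbr-surjective (adj-sym g) in Joined-≃ʳ (reached-unsplit y∉B j) (mk≃ (inj₂ (refl , nbr-j≡x)))

  BothSplit : LV G → Set
  BothSplit ((x , y) , _) = x ∈ B × y ∈ B

  BothSplit-resp : ∀ {e e′} → e ≃ e′ → BothSplit e → BothSplit e′
  BothSplit-resp (mk≃ (inj₁ (refl , refl))) = λ split → split
  BothSplit-resp (mk≃ (inj₂ (refl , refl))) = swap

  Isolated : LV G → Set
  Isolated e = BothSplit e × (∀ f → HasUnsplitEnd f → Adj e f → Cut e f)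

  Isolated-resp : ∀ {e e′} → e ≃ e′ → Isolated e → Isolated e′
  Isolated-resp e≃e′ (both-split , cut-all) = BothSplit-resp e≃e′ both-split ,
    λ f unsplit-f adj → Cut-resp e≃e′ (≃-refl {f}) (cut-all f unsplit-f (Adj-resp (≃-sym e≃e′) (≃-refl {f}) adj))

  joined-or-isolated : ∀ e → Joined c₀ e ⊎ Isolated e
  joined-or-isolated e with HasUnsplitEnd? e
  ... | yes unsplit-end = inj₁ (joined-unsplitEnd e unsplit-end)
  ... | no both-split with Any.any? (λ f → HasUnsplitEnd? f ×-dec Linked? e f) edges
  ...   | yes attached =
    let f , _ , unsplit-f , link = find attached
    in  inj₁ (Joined-linked (joined-unsplitEnd f unsplit-f) (Linked-sym link))
  ...   | no unattached = inj₂ (split-ends e both-split , λ f unsplit-f adj →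
    decidable-stable (Cut? e f) λ uncut → unattached (Any.map
      (λ {f′} f≈f′ → HasUnsplitEnd-resp (mk≃ {f} {f′} f≈f′) unsplit-f ,
                     Linked-resp ≃-refl (mk≃ {f} {f′} f≈f′) (mkLinked (adj , uncut)))
      (edges-complete f)))
    where
    split-ends : ∀ e → ¬ HasUnsplitEnd e → BothSplit e
    split-ends ((x , y) , _) no-unsplit =
      decidable-stable (x ∈? B) (no-unsplit ∘′ inj₁) , decidable-stable (y ∈? B) (no-unsplit ∘′ inj₂)

  -- Two isolated edges va, vc at a split vertex v, with u = nbr v a and w = nbr v c split as well,
  -- force too many cuts: every edge at u or w other than uv, wv has an unsplit end (B = {u, v, w}
  -- and G is triangle-free), and so does every edge vy with y ∉ {a, c}.  Each of them is cut from the
  -- isolated edge it meets, giving (n - 1) + (n - 1) + 2 (n - 2) = 4 n - 6 > |S| distinct cut pairs.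
  module _ (v : Vertex) {a c : Index} (a≢c : a ≢ c)
           (iso-a : Isolated (edgeAt v a)) (iso-c : Isolated (edgeAt v c)) where
    private
      u w : Vertex
      u = nbr v a
      w = nbr v c

      u≢v : u ≢ v
      u≢v = adjacent⇒≢ (nbr-adjacent v a) ∘′ sym
      w≢v : w ≢ v
      w≢v = adjacent⇒≢ (nbr-adjacent v c) ∘′ sym
      u≢w : u ≢ w
      u≢w = a≢c ∘′ nbr-injective v
      ¬u~w : ¬ G u w
      ¬u~w = triangle-free (adj-sym (nbr-adjacent v a)) (nbr-adjacent v c)

      only-three : ∀ {x} → x ∈ B → x ≡ u ⊎ x ≡ v ⊎ x ≡ w
      only-three {x} x∈B with x ≟V u | x ≟V v | x ≟V w
      ... | yes x≡u | _       | _       = inj₁ x≡u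
      ... | no _    | yes x≡v | _       = inj₂ (inj₁ x≡v)
      ... | no _    | no _    | yes x≡w = inj₂ (inj₂ x≡w)
      ... | no x≢u  | no x≢v  | no x≢w  = ⊥-elim (no-four-split
        ((u≢v ∷ u≢w ∷ (x≢u ∘′ sym) ∷ []) ∷ ((w≢v ∘′ sym) ∷ (x≢v ∘′ sym) ∷ []) ∷ ((x≢w ∘′ sym) ∷ []) ∷ [] ∷ [])
        (proj₂ (proj₁ iso-a) ∷ proj₁ (proj₁ iso-a) ∷ proj₂ (proj₁ iso-c) ∷ x∈B ∷ []))

      iu : Index
      iu = proj₁ (nbr-surjective (adj-sym (nbr-adjacent v a)))
      nbr-iu : nbr u iu ≡ v
      nbr-iu = proj₂ (nbr-surjective (adj-sym (nbr-adjacent v a)))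
      iw : Index
      iw = proj₁ (nbr-surjective (adj-sym (nbr-adjacent v c)))
      nbr-iw : nbr w iw ≡ v
      nbr-iw = proj₂ (nbr-surjective (adj-sym (nbr-adjacent v c)))

      unsplit-at-u : ∀ y → y ≢ iu → nbr u y ∉ B
      unsplit-at-u y y≢iu y∈B with only-three y∈B
      ... | inj₁ nbr≡u         = adjacent⇒≢ (nbr-adjacent u y) (sym nbr≡u)
      ... | inj₂ (inj₁ nbr≡v) = y≢iu (nbr-injective u (trans nbr≡v (sym nbr-iu)))
      ... | inj₂ (inj₂ nbr≡w) = ¬u~w (subst (G u) nbr≡w (nbr-adjacent u y))

      unsplit-at-w : ∀ y → y ≢ iw → nbr w y ∉ B
      unsplit-at-w y y≢iw y∈B with only-three y∈B
      ... | inj₁ nbr≡u         = ¬u~w (adj-sym (subst (G w) nbr≡u (nbr-adjacent w y)))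
      ... | inj₂ (inj₁ nbr≡v) = y≢iw (nbr-injective w (trans nbr≡v (sym nbr-iw)))
      ... | inj₂ (inj₂ nbr≡w) = adjacent⇒≢ (nbr-adjacent w y) (sym nbr≡w)

      unsplit-at-v : ∀ y → y ≢ a → y ≢ c → nbr v y ∉ B
      unsplit-at-v y y≢a y≢c y∈B with only-three y∈B
      ... | inj₁ nbr≡u         = y≢a (nbr-injective v nbr≡u)
      ... | inj₂ (inj₁ nbr≡v) = adjacent⇒≢ (nbr-adjacent v y) (sym nbr≡v)
      ... | inj₂ (inj₂ nbr≡w) = y≢c (nbr-injective v nbr≡w)

      beyond : Fin (suc k) → Index
      beyond t = punchIn a (punchIn (punchOut a≢c) t)
      beyond≢a : ∀ t → beyond t ≢ a
      beyond≢a t = FinP.punchInᵢ≢i a _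
      beyond≢c : ∀ t → beyond t ≢ c
      beyond≢c t eq = FinP.punchInᵢ≢i (punchOut a≢c) t
        (FinP.punchIn-injective a _ _ (trans eq (sym (FinP.punchIn-punchOut a≢c))))
      beyond-injective : ∀ {t t′} → beyond t ≡ beyond t′ → t ≡ t′
      beyond-injective eq = FinP.punchIn-injective _ _ _ (FinP.punchIn-injective a _ _ eq)

      iso-u : Isolated (edgeAt u iu)
      iso-u = Isolated-resp {edgeAt v a} {edgeAt u iu} (mk≃ (inj₂ (sym nbr-iu , refl))) iso-a
      iso-w : Isolated (edgeAt w iw)
      iso-w = Isolated-resp {edgeAt v c} {edgeAt w iw} (mk≃ (inj₂ (sym nbr-iw , refl))) iso-c

      cut-at : ∀ {x i} → Isolated (edgeAt x i) → ∀ j → i ≢ j → nbr x j ∉ B → Cut (edgeAt x i) (edgeAt x j)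
      cut-at {x} (_ , cut-all) j i≢j nbr∉B = cut-all (edgeAt x j) (inj₂ nbr∉B) (edgeAt-adjacent x i≢j)

      module At-u  = Spokes u iu (punchIn iu) (FinP.punchIn-injective iu _ _) (FinP.punchInᵢ≢i iu)
        (λ t → cut-at iso-u _ (FinP.punchInᵢ≢i iu t ∘′ sym) (unsplit-at-u _ (FinP.punchInᵢ≢i iu t)))
      module At-w  = Spokes w iw (punchIn iw) (FinP.punchIn-injective iw _ _) (FinP.punchInᵢ≢i iw)
        (λ t → cut-at iso-w _ (FinP.punchInᵢ≢i iw t ∘′ sym) (unsplit-at-w _ (FinP.punchInᵢ≢i iw t)))
      module At-va = Spokes v a beyond beyond-injective beyond≢a
        (λ t → cut-at iso-a _ (beyond≢a t ∘′ sym) (unsplit-at-v _ (beyond≢a t) (beyond≢c t)))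
      module At-vc = Spokes v c beyond beyond-injective beyond≢c
        (λ t → cut-at iso-c _ (beyond≢c t ∘′ sym) (unsplit-at-v _ (beyond≢a t) (beyond≢c t)))

      cutPairs : List CutPair
      cutPairs = At-u.cutPairs ++ At-w.cutPairs ++ At-va.cutPairs ++ At-vc.cutPairs

      length-cutPairs : length cutPairs ≡ suc (suc k) + (suc (suc k) + (suc k + suc k))
      length-cutPairs = trans (length-++ At-u.cutPairs) (cong₂ _+_ At-u.length-cutPairs
        (trans (length-++ At-w.cutPairs) (cong₂ _+_ At-w.length-cutPairs
          (trans (length-++ At-va.cutPairs) (cong₂ _+_ At-va.length-cutPairs At-vc.length-cutPairs)))))

      centre≢ : ∀ {y x ds} → All (λ d → centre d ≡ y) ds → y ≢ x → All (λ d → centre d ≢ x) ds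
      centre≢ centres y≢x = All.map (λ centre≡y centre≡x → y≢x (trans (sym centre≡y) centre≡x)) centres

      cutPairs-distinct : AllPairs (λ c d → ¬ SameCutPair c d) cutPairs
      cutPairs-distinct = AllPairsP.++⁺ At-u.cutPairs-distinct
        (AllPairsP.++⁺ At-w.cutPairs-distinct
          (AllPairsP.++⁺ At-va.cutPairs-distinct At-vc.cutPairs-distinct
            (All-across (λ { (refl , _) (refl , _)      (_ , inj₁ (a≡c , _))      → a≢c a≡c
                           ; (refl , _) (refl , t , refl) (_ , inj₂ (a≡beyond , _)) → beyond≢a t (sym a≡beyond) })
                        At-va.shape-cutPairs At-vc.shape-cutPairs))
          (apart-by-centre At-w.centre-cutPairs
            (AllP.++⁺ (centre≢ At-va.centre-cutPairs (w≢v ∘′ sym)) (centre≢ At-vc.centre-cutPairs (w≢v ∘′ sym)))))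
        (apart-by-centre At-u.centre-cutPairs
          (AllP.++⁺ (centre≢ At-w.centre-cutPairs (u≢w ∘′ sym))
            (AllP.++⁺ (centre≢ At-va.centre-cutPairs (u≢v ∘′ sym)) (centre≢ At-vc.centre-cutPairs (u≢v ∘′ sym)))))

      too-many : ∀ k → suc (suc k) + (suc (suc k) + (suc k + suc k)) + 7 ≡ suc (4 * suc (suc (suc k)))
      too-many = solve-∀

    isolated-pair-at-vertex-impossible : ⊥
    isolated-pair-at-vertex-impossible = ℕP.<-irrefl refl (subst (_≤ 4 * suc (suc (suc k))) (too-many k)
      (ℕP.≤-trans (ℕP.+-monoˡ-≤ 7 |cutPairs|≤|S|) |S|+7≤4n))
      where
      |cutPairs|≤|S| : suc (suc k) + (suc (suc k) + (suc k + suc k)) ≤ length S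
      |cutPairs|≤|S| = subst (_≤ length S) length-cutPairs (length-cutPairs≤ cutPairs cutPairs-distinct)

  shared-endpoint : ∀ e₁ e₂ → BothSplit e₁ → BothSplit e₂ → ∃ λ z → Endpoint e₁ z × Endpoint e₂ z
  shared-endpoint ((p₁ , q₁) , g₁) ((p₂ , q₂) , g₂) (p₁∈B , q₁∈B) (p₂∈B , q₂∈B)
    with p₁ ≟V p₂ | p₁ ≟V q₂ | q₁ ≟V p₂ | q₁ ≟V q₂
  ... | yes p₁≡p₂ | _         | _         | _         = p₁ , inj₁ refl , inj₁ (sym p₁≡p₂)
  ... | no _      | yes p₁≡q₂ | _         | _         = p₁ , inj₁ refl , inj₂ (sym p₁≡q₂)
  ... | no _      | no _      | yes q₁≡p₂ | _         = q₁ , inj₂ refl , inj₁ (sym q₁≡p₂)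
  ... | no _      | no _      | no _      | yes q₁≡q₂ = q₁ , inj₂ refl , inj₂ (sym q₁≡q₂)
  ... | no p₁≢p₂  | no p₁≢q₂  | no q₁≢p₂  | no q₁≢q₂  = ⊥-elim (no-four-split
    ((adjacent⇒≢ g₁ ∷ p₁≢p₂ ∷ p₁≢q₂ ∷ []) ∷ (q₁≢p₂ ∷ q₁≢q₂ ∷ []) ∷ (adjacent⇒≢ g₂ ∷ []) ∷ [] ∷ [])
    (p₁∈B ∷ q₁∈B ∷ p₂∈B ∷ q₂∈B ∷ []))

  isolated-unique : ∀ {e₁ e₂} → Isolated e₁ → Isolated e₂ → e₁ ≃ e₂
  isolated-unique {e₁} {e₂} iso₁ iso₂ = decidable-stable (e₁ ≃? e₂) λ e₁≄e₂ →
    let z , end₁ , end₂ = shared-endpoint e₁ e₂ (proj₁ iso₁) (proj₁ iso₂)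
        a , za≃e₁ = edgeAt-endpoint e₁ end₁
        c , zc≃e₂ = edgeAt-endpoint e₂ end₂
    in isolated-pair-at-vertex-impossible z
         (λ a≡c → e₁≄e₂ (≃-trans (≃-sym za≃e₁) (subst (λ i → edgeAt z i ≃ e₂) (sym a≡c) zc≃e₂)))
         (Isolated-resp (≃-sym za≃e₁) iso₁) (Isolated-resp (≃-sym zc≃e₂) iso₂)

  all-but-one-joined : ∃ λ e₁ → ∀ e → ¬ e ≃ e₁ → Joined c₀ e
  all-but-one-joined with all-or-any joined-or-isolated edges
  ... | inj₁ all-joined = c₀ , λ e _ →
    let e′ , e′∈edges , e≈e′ = find (edges-complete e)
    in  Joined-≃ʳ (All.lookup all-joined e′∈edges) (≃-sym (mk≃ {e} {e′} e≈e′))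
  ... | inj₂ some-isolated = let e₁ , _ , iso₁ = find some-isolated in e₁ , λ e e≄e₁ →
    Sum.[ (λ joined → joined) , (λ iso → ⊥-elim (e≄e₁ (isolated-unique iso iso₁))) ]′ (joined-or-isolated e)

  order : ℕ
  order = suc (suc (suc k)) * 2 ^ suc (suc k)

  component : HasComponentOfSize G S (order ∸ 1)
  component = c₀ , c₀ ∷ rest , size , c₀≉rest ∷ rest-distinct , ε ∷ All.tabulate path
    where
    e₁ : LV G
    e₁ = proj₁ all-but-one-joined

    rest : List (LV G)
    rest = without e₁ (without c₀ edges)

    ∈-rest⁻ : ∀ {e} → e ∈ rest → ¬ e ≃ c₀ × ¬ e ≃ e₁
    ∈-rest⁻ e∈rest = let e∈ , e≄e₁ = ∈-without⁻ e₁ {without c₀ edges} e∈rest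
                     in  proj₂ (∈-without⁻ c₀ {edges} e∈) , e≄e₁

    size : order ∸ 1 ≤ suc (length rest)
    size = ℕP.m≤n+o⇒m∸n≤o order 1 (begin
      order                              ≡⟨ length-edges ⟨
      length edges                       ≤⟨ length-without c₀ edges-distinct ⟩
      suc (length (without c₀ edges))    ≤⟨ s≤s (length-without e₁ (without-distinct c₀ edges-distinct)) ⟩
      suc (suc (length rest))            ∎)
      where open ℕP.≤-Reasoning

    c₀≉rest : All (λ e → ¬ _≈E_ {G = G} c₀ e) rest
    c₀≉rest = All.tabulate λ {e} e∈rest c₀≈e → proj₁ (∈-rest⁻ e∈rest) (≃-sym (mk≃ {c₀} {e} c₀≈e))

    rest-distinct : AllPairs (λ e e′ → ¬ _≈E_ {G = G} e e′) rest
    rest-distinct = without-distinct e₁ (without-distinct c₀ edges-distinct)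

    path : ∀ {e} → e ∈ rest → Star (LminusAdj G S) c₀ e
    path e∈rest with Joined⇒path (proj₂ all-but-one-joined _ (proj₂ (∈-rest⁻ e∈rest)))
    ... | inj₁ linked = gmap (λ e → e) unLinked linked
    ... | inj₂ c₀≃e   = ⊥-elim (proj₁ (∈-rest⁻ e∈rest) (≃-sym c₀≃e))

lemma3p2 : (n : ℕ) → 3 ≤ n → (G : Graph (V n)) → HL n G →
    (S : List (LV G × LV G)) → All (λ st → LAdj G (proj₁ st) (proj₂ st)) S →
    length S ≤ 4 * n ∸ 7 →
    HasComponentOfSize G S (n * 2 ^ (n ∸ 1) ∸ 1)
-- only the number of entries of S matters, not that they are edges of L(G)
lemma3p2 (suc (suc (suc k))) _ G hl S _ |S|≤4n-7 = LargeComponent.component (HL⇒facts hl) S |S|+7≤4n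
  where
  |S|+7≤4n : length S + 7 ≤ 4 * suc (suc (suc k))
  |S|+7≤4n = ℕP.≤-trans (ℕP.+-monoˡ-≤ 7 |S|≤4n-7) (ℕP.≤-reflexive (ℕP.m∸n+n≡m 7≤4n))
    where
    7≤4n : 7 ≤ 4 * suc (suc (suc k))
    7≤4n = ℕP.≤-trans (ℕP.m≤m+n 7 5) (ℕP.*-monoʳ-≤ 4 (s≤s (s≤s (s≤s (z≤n {k})))))
lemma3p2 (suc zero)       (s≤s ())
lemma3p2 (suc (suc zero)) (s≤s (s≤s ()))
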